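{- Let $\mathcal{M}$ be an $\mathit{LTL}$-model, $[n_1,\ldots,n_k]$ an observation sequence, and $A$ an $\mathit{LTL}$-formula. Then $\mathcal{M},[n_1,\ldots,n_k]\models_{\nabla} A^*$ if and only if $\mathcal{M},[m_1,\ldots,m_r,n_k]\models_{\nabla} A^*$ for every sequence $m_1,\ldots,m_r$ of natural numbers.
   Context: Fix a set $\mathcal{P}$ of propositional symbols. $\mathit{LTL}$-formulas: $A ::= p \mid \bot \mid A\supset A \mid \mathsf{G}A \mid \mathsf{X}A \mid A\,\mathsf{U}\,A$ ($p\in\mathcal{P}$). $\mathit{LTL}_\nabla$-formulas: $A ::= p \mid \bot \mid A\supset A \mid \mathsf{G}A \mid \mathsf{X}A \mid \nabla A$. In both languages $\neg A := A\supset\bot$, $A\vee B := \neg A\supset B$, $A\wedge B := \neg(\neg A\vee\neg B)$, $\mathsf{F}A := \neg\mathsf{G}\neg A$. An $\mathit{LTL}$-model is $\mathcal{M}=\langle \mathbb{N},\mathcal{V}\rangle$ with $\mathcal{V}:\mathbb{N}\to 2^{\mathcal{P}}$ (natural numbers with successor and usual order $\le$). An observation sequence is a non-empty finite sequence $[n_0,\ldots,n_k]$ of natural numbers. Truth $\models_\nabla$ of $\mathit{LTL}_\nabla$-formulas at observation sequences: $\mathcal{M},[n_0,\ldots,n_k]\models_\nabla p$ iff $p\in\mathcal{V}(n_k)$; $\bot$ is never true; $\supset$ is classical implication at the same sequence; $\mathcal{M},[n_0,\ldots,n_k]\models_\nabla\mathsf{G}A$ iff $\mathcal{M},[n_0,\ldots,n_k,m]\models_\nabla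 A$ for all $m\ge n_k$; $\mathcal{M},[n_0,\ldots,n_k]\models_\nabla\mathsf{X}A$ iff $\mathcal{M},[n_0,\ldots,n_k,n_k+1]\models_\nabla A$; if $k>0$, $\mathcal{M},[n_0,\ldots,n_{k-1},n_k]\models_\nabla\nabla A$ iff $\mathcal{M},[n_0,\ldots,n_{k-1},m]\models_\nabla A$ for all $m$ with $n_{k-1}\le m\le n_k$; and $\mathcal{M},[n_0]\models_\nabla\nabla A$ iff $\mathcal{M},[n_0]\models_\nabla A$. The translation $(\cdot)^*$ from $\mathit{LTL}$ to $\mathit{LTL}_\nabla$: $p^*=p$, $\bot^*=\bot$, $(A\supset B)^*=A^*\supset B^*$, $(\mathsf{G}A)^*=\mathsf{G}A^*$, $(\mathsf{X}A)^*=\mathsf{X}A^*$, $(A\,\mathsf{U}\,B)^* = B^*\vee \mathsf{F}(\mathsf{X}B^*\wedge\nabla A^*)$. -}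

module Defs where

open import Data.Nat using (ℕ; suc; _≤_)
open import Data.List using (List; []; _∷_; reverse)
open import Data.Empty using (⊥)

data LTL (P : Set) : Set where
  atom : P → LTL P
  ⊥'   : LTL P
  _⊃_  : LTL P → LTL P → LTL P
  G    : LTL P → LTL P
  X    : LTL P → LTL P
  _U_  : LTL P → LTL P → LTL P

data LTL∇ (P : Set) : Set where
  atom : P → LTL∇ P
  ⊥'   : LTL∇ P
  _⊃_  : LTL∇ P → LTL∇ P → LTL∇ P
  G    : LTL∇ P → LTL∇ P
  X    : LTL∇ P → LTL∇ P
  ∇    : LTL∇ P → LTL∇ P

module _ {P : Set} where
  ¬∇_ : LTL∇ P → LTL∇ P
  ¬∇ A = A ⊃ ⊥'

  _∨∇_ : LTL∇ P → LTL∇ P → LTL∇ P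
  A ∨∇ B = (¬∇ A) ⊃ B

  _∧∇_ : LTL∇ P → LTL∇ P → LTL∇ P
  A ∧∇ B = ¬∇ ((¬∇ A) ∨∇ (¬∇ B))

  F∇ : LTL∇ P → LTL∇ P
  F∇ A = ¬∇ (G (¬∇ A))

  _* : LTL P → LTL∇ P
  atom p * = atom p
  ⊥' * = ⊥'
  (A ⊃ B) * = (A *) ⊃ (B *)
  G A * = G (A *)
  X A * = X (A *)
  (A U B) * = (B *) ∨∇ F∇ (X (B *) ∧∇ ∇ (A *))

-- An LTL-model ⟨ℕ, V⟩ with V : ℕ → 2^P, a subset of P given as a predicate.
Model : Set → Set₁
Model P = ℕ → P → Set

-- Truth at an observation sequence, with the earlier elements stored in
-- reverse order (most recent first): satRev M hist n A means
-- M, reverse hist ++ [n] ⊨∇ A.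
satRev : {P : Set} → Model P → List ℕ → ℕ → LTL∇ P → Set
satRev V hist n (atom p) = V n p
satRev V hist n ⊥' = ⊥
satRev V hist n (A ⊃ B) = satRev V hist n A → satRev V hist n B
satRev V hist n (G A) = (m : ℕ) → n ≤ m → satRev V (n ∷ hist) m A
satRev V hist n (X A) = satRev V (n ∷ hist) (suc n) A
satRev V [] n (∇ A) = satRev V [] n A
satRev V (p ∷ hist) n (∇ A) = (m : ℕ) → p ≤ m → m ≤ n → satRev V (p ∷ hist) m A

-- M, [ns₀, …, ns_{r-1}, n] ⊨∇ A   (an observation sequence is ns ++ [n], non-empty)
_,_∷ʳ_⊨∇_ : {P : Set} → Model P → List ℕ → ℕ → LTL∇ P → Set
V , ns ∷ʳ n ⊨∇ A = satRev V (reverse ns) n A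

-- Below the most recent observation p the history is never consulted: G and X
-- push the current point, and ∇ looks back only as far as p. So truth at p ∷ h
-- does not depend on h. A translation A* is history-free outright, because in
-- it ∇ occurs only beneath F, i.e. after a G has pushed the current point.
module Submission where

open import Defs
open import Data.Nat using (ℕ)
open import Data.List using (List; _∷_; reverse)
open import Data.Product using (_×_; _,_)

module _ {P : Set} (V : Model P) where

  -- Stated for arbitrary h and h', so the contravariant premise of ⊃ is
  -- handled by the same statement with h and h' swapped.
  satRev-tail-irrelevant : ∀ (A : LTL∇ P) {p n} (h h' : List ℕ) →
    satRev V (p ∷ h) n A → satRev V (p ∷ h') n A
  satRev-tail-irrelevant (atom _) h h' a = a
  satRev-tail-irrelevant ⊥' h h' ()
  satRev-tail-irrelevant (A ⊃ B) h h' f a =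
    satRev-tail-irrelevant B h h' (f (satRev-tail-irrelevant A h' h a))
  satRev-tail-irrelevant (G A) {p} h h' g m n≤m =
    satRev-tail-irrelevant A (p ∷ h) (p ∷ h') (g m n≤m)
  satRev-tail-irrelevant (X A) {p} h h' a =
    satRev-tail-irrelevant A (p ∷ h) (p ∷ h') a
  satRev-tail-irrelevant (∇ A) h h' g m p≤m m≤n =
    satRev-tail-irrelevant A h h' (g m p≤m m≤n)

  satRev-*-history-irrelevant : ∀ (A : LTL P) {n} (h h' : List ℕ) →
    satRev V h n (A *) → satRev V h' n (A *)
  satRev-*-history-irrelevant (atom _) h h' a = a
  satRev-*-history-irrelevant ⊥' h h' ()
  satRev-*-history-irrelevant (A ⊃ B) h h' f a =
    satRev-*-history-irrelevant B h h' (f (satRev-*-history-irrelevant A h' h a))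
  satRev-*-history-irrelevant (G A) h h' g m n≤m =
    satRev-tail-irrelevant (A *) h h' (g m n≤m)
  satRev-*-history-irrelevant (X A) h h' a =
    satRev-tail-irrelevant (A *) h h' a
  satRev-*-history-irrelevant (A U B) h h' until ¬B never =
    until (λ b → ¬B (satRev-*-history-irrelevant B h h' b))
          (λ m n≤m φ → never m n≤m (satRev-tail-irrelevant (X (B *) ∧∇ ∇ (A *)) h h' φ))

lemma1 : {P : Set} (M : Model P) (ns : List ℕ) (nk : ℕ) (A : LTL P) →
    ((M , ns ∷ʳ nk ⊨∇ (A *)) → ((ms : List ℕ) → M , ms ∷ʳ nk ⊨∇ (A *)))
    × (((ms : List ℕ) → M , ms ∷ʳ nk ⊨∇ (A *)) → (M , ns ∷ʳ nk ⊨∇ (A *)))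
lemma1 M ns nk A =
  (λ a ms → satRev-*-history-irrelevant M A (reverse ns) (reverse ms) a) ,
  (λ a → a ns)
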